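{- Let $\mathcal{R}$ be any rule set with $\{(\Box,\Box),(\Box,\ast)\}\subseteq\mathcal{R}$ and write $\vdash$ for $\vdash^{\mathcal R}$ of the $\mathfrak{f}$-cube. Then for every $H\in\{F,S,B,Q,G,M,A\}$, $\delta^y,\delta^{z_3}\vdash H:\ast$; for every $J\in\{E,D,R\}$, $\delta^y\vdash J:\ast$; moreover $\delta^y,\delta^{z_2}\vdash C:\ast$ and $\delta^y,\delta^{z_2}\vdash R':\ast$.
   Context: Sorts $\ast,\Box$; variables $x^\varsigma$ are marked with a sort. Terms: $A::=\ast\mid\Box\mid x\mid \pi\,x\rho{:}A.\,B\mid A\,B$ with $\pi\in\{\lambda,\Pi\}$ and restriction $\rho=\overline{\in}\{A_1,\dots,A_i\}$, $i\ge0$; $\diamond=\overline{\in}\{\}$, and $x\diamond{:}A$ is written $x{:}A$. Contexts are finite sequences of declarations $x\rho{:}A$; $\mathrm{rdec}(\Delta)$ is the sequence of pairs $x\rho$ for declarations of $\Delta$ with $\rho\neq\diamond$. $\beta$ is the compatible closure of $(\lambda x\rho{:}A.B)C\to B[x:=C]$; $=_\beta$ its equivalence closure. Restriction satisfaction: (ref) $\varepsilon\Vdash B\,\overline{\in}\{A_1,\dots,A_n\}$ if $B=_\beta A_i$ for some $i$; (ctR) if $x\notin\mathrm{dom}(\Gamma)$ and for all $i\in1..n$, $\Gamma[x:=A_i]\Vdash B[x:=A_i]\,\rho[x:=A_i]$, then $(x\,\overline{\in}\{A_1,\dots,A_n\}),\Gamma\Vdash B\rho$. Typing rules of $\vdash^{\mathcal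 R}$ ($\mathcal R$ a set of pairs of sorts containing $(\ast,\ast)$): (axiom) $\varepsilon\vdash\ast:\Box$; (weak) from $\Delta,\delta\vdash A:B$ and $\Delta\vdash C:D$ infer $\Delta,\delta\vdash C:D$; (start) if $x^\varsigma\notin\mathrm{dom}(\Delta)$, $\Delta\vdash A:\varsigma$ and, for $\rho=\overline{\in}\{B_1,\dots,B_n\}$, $\Delta\vdash B_j:A$ for all $j$, then $\Delta,x^\varsigma\rho{:}A\vdash x^\varsigma:A$; ($\Pi$) from $\Delta,x\rho{:}A\vdash B:\varsigma$, $\Delta\vdash A:\varsigma'$, $(\varsigma',\varsigma)\in\mathcal R$ infer $\Delta\vdash\Pi x\rho{:}A.B:\varsigma$; ($\lambda$) from $\Delta,\delta\vdash B':B$ and $\Delta\vdash\Pi\delta.B:\varsigma$ infer $\Delta\vdash\lambda\delta.B':\Pi\delta.B$; (app) from $\Delta\vdash F:\Pi x\rho{:}C.B$, $\Delta\vdash A:C$ and (if $\rho\ne\diamond$) $\mathrm{rdec}(\Delta)\Vdash A\rho$ infer $\Delta\vdash FA:B[x:=A]$; (conv) from $\Delta\vdash A:B$, $\Delta\vdash C:\varsigma$, $\mathrm{rdec}(\Delta)\Vdash B\,\overline{\in}\{C\}$ infer $\Delta\vdash A:C$. Degree: $\sharp(\Box)=3,\sharp(\ast)=2,\sharp(x^\varsigma)=\sharp(\varsigma)-2$, $\sharp(\pi\delta.A)=\sharp(AB)=\sharp(A)$. $A\to B=\Pi w^\varsigma{:}A.B$ ($w$ not free in $B$; $\varsigma=\ast$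 if $\sharp(A)=1$, $\varsigma=\Box$ if $\sharp(A)=2$), right-associative. $\ast_0=\ast$, $\ast_{i+1}=\ast\to\ast_i$. $\delta^y=y^\Box{:}\ast$; $\delta^{x_i}=x_i^\Box{:}\ast$; $P_{i,q}=\lambda\delta^{x_1}.\cdots.\lambda\delta^{x_q}.x_i$; $\delta^{z_q}=z_q^\Box\,\overline{\in}\{P_{1,q},\dots,P_{q,q}\}{:}\ast_q$. $\overline{X}=X\to X$, $\widetilde{X}=\overline{X}\to X$, $\underline{X}=X\to\widetilde{X}$, $\overline{X}^{\,0}=X$, $\overline{X}^{\,i+1}=\overline{\overline{X}^{\,i}}$, $\underline{X}_0=X$, $\underline{X}_{i+1}=\underline{\underline{X}_i}$. Specific terms: $F=z_3\,\overline{y}^{\,3}\,\overline{y}^{\,2}\,\overline{y}$; $S=z_3\,\overline{y}^{\,2}\,\overline{y}^{\,1}\,y$; $Q=z_3\,\underline{y}\,y\,\underline{y}$; $G=z_3\,\underline{y}_2\,\overline{y}\,\overline{(\underline{y})}$; $M=z_3\,\widetilde{(\underline{y})}\,y\,\underline{y}$; $B=F\to S\to S$; $A=Q\to G\to M$; $E=\Pi\delta^{z_3}.B$; $D=\Pi\delta^{z_3}.A$; $C_1=\overline{y}^{\,2}$; $C_2=\widetilde{(\underline{y})}$; $C=z_2\,C_1\,C_2$; $O=z_2\,E\,D$; $R'=O\to C$; $R=\Pi\delta^{z_2}.R'$. -}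

module Defs where

open import Data.Nat using (ℕ; zero; suc; _∸_; _<ᵇ_; _≡ᵇ_)
open import Data.Bool using (Bool; true; false; if_then_else_)
open import Data.List using (List; []; _∷_; length; reverse; map; upTo)
open import Data.List.Relation.Unary.Any using (Any)
open import Data.List.Relation.Unary.All using (All)
open import Data.List.Membership.Propositional using (_∈_)
open import Data.Unit using (⊤)
open import Relation.Binary.Construct.Closure.Equivalence using (EqClosure)

-- Syntax (de Bruijn indices; index 0 = innermost binder).
-- A variable x^ς is represented by an index; its sort ς is recorded at
-- its binder / declaration.

data Sort : Set where
  star box : Sort

data Binder : Set where
  lam pi : Binder

-- bind π ς ρ A B  represents  π x^ς ρ : A . B  where ρ = ∈̄{A₁,…,Aᵢ}
-- is given as the list [A₁,…,Aᵢ] (the empty list is ◇).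
data Term : Set where
  srt  : Sort → Term
  var  : ℕ → Term
  bind : Binder → Sort → List Term → Term → Term → Term
  app  : Term → Term → Term

Restriction : Set
Restriction = List Term

mutual
  lift : ℕ → ℕ → Term → Term
  lift d c (srt s) = srt s
  lift d c (var i) = if i <ᵇ c then var i else var (d Data.Nat.+ i)
  lift d c (bind π s ρ A B) = bind π s (liftL d c ρ) (lift d c A) (lift d (suc c) B)
  lift d c (app M N) = app (lift d c M) (lift d c N)

  liftL : ℕ → ℕ → List Term → List Term
  liftL d c [] = []
  liftL d c (t ∷ ts) = lift d c t ∷ liftL d c ts

wk : Term → Term
wk = lift 1 0

mutual
  -- sub j u t : t[x_j := u], where u lives in the scope outside x_j
  sub : ℕ → Term → Term → Term
  sub j u (srt s) = srt s
  sub j u (var i) =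
    if i <ᵇ j then var i
    else if i ≡ᵇ j then lift j 0 u
    else var (i ∸ 1)
  sub j u (bind π s ρ A B) = bind π s (subL j u ρ) (sub j u A) (sub (suc j) u B)
  sub j u (app M N) = app (sub j u M) (sub j u N)

  subL : ℕ → Term → List Term → List Term
  subL j u [] = []
  subL j u (t ∷ ts) = sub j u t ∷ subL j u ts

mutual
  data _⟶β_ : Term → Term → Set where
    β     : ∀ {s ρ A B C} → app (bind lam s ρ A B) C ⟶β sub 0 C B
    appˡ  : ∀ {M M' N} → M ⟶β M' → app M N ⟶β app M' N
    appʳ  : ∀ {M N N'} → N ⟶β N' → app M N ⟶β app M N'
    bindρ : ∀ {π s ρ ρ' A B} → ρ ⟶βL ρ' → bind π s ρ A B ⟶β bind π s ρ' A B
    bindA : ∀ {π s ρ A A' B} → A ⟶β A' → bind π s ρ A B ⟶β bind π s ρ A' B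
    bindB : ∀ {π s ρ A B B'} → B ⟶β B' → bind π s ρ A B ⟶β bind π s ρ A B'

  data _⟶βL_ : List Term → List Term → Set where
    here  : ∀ {t t' ts} → t ⟶β t' → (t ∷ ts) ⟶βL (t' ∷ ts)
    there : ∀ {t ts ts'} → ts ⟶βL ts' → (t ∷ ts) ⟶βL (t ∷ ts')

_=β_ : Term → Term → Set
_=β_ = EqClosure _⟶β_

-- Contexts.  A context is a list of declarations, head = most recent
-- (innermost) declaration, so  δ ∷ Δ  is  Δ,δ.

record Decl : Set where
  constructor decl
  field
    dsort : Sort
    drest : Restriction
    dtype : Term
open Decl public

Ctx : Set
Ctx = List Decl

-- The restricted-declaration sequence is given outermost-first as a list
-- of restrictions; an entry [] (= ◇) is a declaration that is NOT in
-- rdec(Δ): its variable is simply kept free.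

substR : ℕ → Term → List Restriction → List Restriction
substR p A [] = []
substR p A (σ ∷ Γ) = subL p A σ ∷ substR (suc p) A Γ

data _⊩_⟨_⟩ : List Restriction → Term → Restriction → Set where
  ref  : ∀ {B ρ} → Any (λ A → B =β A) ρ → [] ⊩ B ⟨ ρ ⟩
  skip : ∀ {Γ B ρ} → Γ ⊩ B ⟨ ρ ⟩ → ([] ∷ Γ) ⊩ B ⟨ ρ ⟩
  ctR  : ∀ {A₀ As Γ B ρ} →
         (∀ {A} → A ∈ (A₀ ∷ As) →
            substR 0 A Γ ⊩ sub (length Γ) A B ⟨ subL (length Γ) A ρ ⟩) →
         ((A₀ ∷ As) ∷ Γ) ⊩ B ⟨ ρ ⟩

rdec : Ctx → List Restriction
rdec Δ = reverse (map drest Δ)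

AppRestr : Ctx → Term → Restriction → Set
AppRestr Δ A [] = ⊤
AppRestr Δ A (C ∷ Cs) = rdec Δ ⊩ A ⟨ C ∷ Cs ⟩

RuleSet : Set₁
RuleSet = Sort → Sort → Set

data _⊢[_]_∶_ : Ctx → RuleSet → Term → Term → Set₁ where
  axiom : ∀ {R} → [] ⊢[ R ] srt star ∶ srt box
  weak  : ∀ {R Δ δ A B C D} →
          (δ ∷ Δ) ⊢[ R ] A ∶ B → Δ ⊢[ R ] C ∶ D →
          (δ ∷ Δ) ⊢[ R ] wk C ∶ wk D
  start : ∀ {R Δ ς ρ A} →
          Δ ⊢[ R ] A ∶ srt ς → All (λ Bj → Δ ⊢[ R ] Bj ∶ A) ρ →
          (decl ς ρ A ∷ Δ) ⊢[ R ] var 0 ∶ wk A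
  Πrule : ∀ {R Δ s ρ A B ς ς'} →
          (decl s ρ A ∷ Δ) ⊢[ R ] B ∶ srt ς → Δ ⊢[ R ] A ∶ srt ς' → R ς' ς →
          Δ ⊢[ R ] bind pi s ρ A B ∶ srt ς
  λrule : ∀ {R Δ s ρ A B B' ς} →
          (decl s ρ A ∷ Δ) ⊢[ R ] B' ∶ B → Δ ⊢[ R ] bind pi s ρ A B ∶ srt ς →
          Δ ⊢[ R ] bind lam s ρ A B' ∶ bind pi s ρ A B
  apprule : ∀ {R Δ F s ρ C B A} →
          Δ ⊢[ R ] F ∶ bind pi s ρ C B → Δ ⊢[ R ] A ∶ C → AppRestr Δ A ρ →
          Δ ⊢[ R ] app F A ∶ sub 0 A B
  conv  : ∀ {R Δ A B C ς} →
          Δ ⊢[ R ] A ∶ B → Δ ⊢[ R ] C ∶ srt ς → rdec Δ ⊩ B ⟨ C ∷ [] ⟩ →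
          Δ ⊢[ R ] A ∶ C

-- Degree (relative to the sorts of the free variables, innermost first)

sortDeg : Sort → ℕ
sortDeg box = 3
sortDeg star = 2

lookupSort : List Sort → ℕ → Sort
lookupSort [] i = star            -- unused: free variables are always in the env
lookupSort (s ∷ Γ) zero = s
lookupSort (s ∷ Γ) (suc i) = lookupSort Γ i

deg : List Sort → Term → ℕ
deg Γ (srt s) = sortDeg s
deg Γ (var i) = sortDeg (lookupSort Γ i) ∸ 2
deg Γ (bind π s ρ A B) = deg (s ∷ Γ) B
deg Γ (app M N) = deg Γ M

-- sort of the dummy variable of an arrow: ∗ if degree 1, □ if degree 2
-- (arrows are only used with domains of degree 1 or 2)
arrowSort : ℕ → Sort
arrowSort 2 = box
arrowSort _ = star

arr : List Sort → Term → Term → Term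
arr Γ A B = bind pi (arrowSort (deg Γ A)) [] A (wk B)

⋆ : Term
⋆ = srt star

starN : ℕ → Term
starN zero = ⋆
starN (suc i) = arr [] ⋆ (starN i)

lams : ℕ → Term → Term
lams zero t = t
lams (suc n) t = bind lam box [] ⋆ (lams n t)

P : ℕ → ℕ → Term
P i q = lams q (var (q ∸ i))

δz : ℕ → Decl
δz q = decl box (map (λ i → P (suc i) q) (upTo q)) (starN q)

δy : Decl
δy = decl box [] ⋆

module Ops (Γ : List Sort) where
  bar : Term → Term
  bar X = arr Γ X X
  tilde : Term → Term
  tilde X = arr Γ (bar X) X
  under : Term → Term
  under X = arr Γ X (tilde X)
  barN : ℕ → Term → Term
  barN zero X = X
  barN (suc i) X = bar (barN i X)
  underN : ℕ → Term → Term
  underN zero X = X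
  underN (suc i) X = under (underN i X)

Γ₂ : List Sort
Γ₂ = box ∷ box ∷ []

app3 : Term → Term → Term → Term → Term
app3 z a b c = app (app (app z a) b) c

-- Context δ^y, δ^{z_3}: y = var 1, z₃ = var 0
ctxYZ3 : Ctx
ctxYZ3 = δz 3 ∷ δy ∷ []

-- Context δ^y: y = var 0
ctxY : Ctx
ctxY = δy ∷ []

-- Context δ^y, δ^{z_2}: y = var 1, z₂ = var 0
ctxYZ2 : Ctx
ctxYZ2 = δz 2 ∷ δy ∷ []

module Y1 where
  open Ops Γ₂ public
  y z : Term
  y = var 1
  z = var 0

termF termS termQ termG termM termB termA : Term
termF = app3 Y1.z (Y1.barN 3 Y1.y) (Y1.barN 2 Y1.y) (Y1.barN 1 Y1.y)
termS = app3 Y1.z (Y1.barN 2 Y1.y) (Y1.barN 1 Y1.y) Y1.y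
termQ = app3 Y1.z (Y1.under Y1.y) Y1.y (Y1.under Y1.y)
termG = app3 Y1.z (Y1.underN 2 Y1.y) (Y1.bar Y1.y) (Y1.bar (Y1.under Y1.y))
termM = app3 Y1.z (Y1.tilde (Y1.under Y1.y)) Y1.y (Y1.under Y1.y)
termB = arr Γ₂ termF (arr Γ₂ termS termS)
termA = arr Γ₂ termQ (arr Γ₂ termG termM)

termE termD : Term
termE = bind pi box (drest (δz 3)) (dtype (δz 3)) termB
termD = bind pi box (drest (δz 3)) (dtype (δz 3)) termA

termC₁ termC₂ termC termO termR' termR : Term
termC₁ = Y1.barN 2 Y1.y
termC₂ = Y1.tilde (Y1.under Y1.y)
termC = app (app Y1.z termC₁) termC₂
termO = app (app Y1.z (wk termE)) (wk termD)
termR' = arr Γ₂ termO termC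
termR = bind pi box (drest (δz 2)) (dtype (δz 2)) termR'

{-# OPTIONS --safe #-}
module Submission where

-- Every type in question is built from the variable y : ∗ by non-dependent arrows, which keep
-- degree 1 and so are formed with (∗,∗), and from applications of z_q : ∗_q. The kinds ∗_q are
-- formed with (□,□); declaring z_q is legitimate because each P_{i,q} = λx₁…x_q. x_i inhabits ∗_q,
-- and applying z_q never triggers a restriction check, since the binders of ∗_q are unrestricted.
-- Abstracting z_q over a type (E, D, R) is a (□,∗) product.

open import Defs
open import Data.List using (List; []; _∷_; _++_; length)
open import Data.List.Relation.Unary.All using (All; []; _∷_)
open import Data.List.Relation.Unary.All.Properties using (map⁺; applyUpTo⁺₁)
open import Data.Nat using (ℕ; zero; suc; _<_; _<ᵇ_; z<s; s<s)
open import Data.Nat.Properties using (∸-monoʳ-<)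
open import Data.Bool using (true; false)
open import Data.Product using (_×_; _,_)
open import Data.Unit using (tt)
open import Relation.Binary.PropositionalEquality
  using (_≡_; refl; sym; trans; cong; subst; module ≡-Reasoning)
open ≡-Reasoning

private variable
  R : RuleSet
  Δ : Ctx
  A B C D F X : Term
  ς ς′ : Sort
  ρ : Restriction
  q : ℕ

lift-starN : ∀ d c q → lift d c (starN q) ≡ starN q
lift-starN d c zero = refl
lift-starN d c (suc q) =
  cong (bind pi box [] ⋆) (begin
    lift d (suc c) (wk (starN q)) ≡⟨ cong (lift d (suc c)) (lift-starN 1 0 q) ⟩
    lift d (suc c) (starN q)      ≡⟨ lift-starN d (suc c) q ⟩
    starN q                       ≡⟨ sym (lift-starN 1 0 q) ⟩
    wk (starN q)                  ∎)

sub-starN : ∀ j u q → sub j u (starN q) ≡ starN q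
sub-starN j u zero = refl
sub-starN j u (suc q) =
  cong (bind pi box [] ⋆) (begin
    sub (suc j) u (wk (starN q)) ≡⟨ cong (sub (suc j) u) (lift-starN 1 0 q) ⟩
    sub (suc j) u (starN q)      ≡⟨ sub-starN (suc j) u q ⟩
    starN q                      ≡⟨ sym (lift-starN 1 0 q) ⟩
    wk (starN q)                 ∎)

deg-lift-var : ∀ Γ₁ Γ₂ s i →
  deg (Γ₁ ++ s ∷ Γ₂) (lift 1 (length Γ₁) (var i)) ≡ deg (Γ₁ ++ Γ₂) (var i)
deg-lift-var []       Γ₂ s i       = refl
deg-lift-var (_ ∷ Γ₁) Γ₂ s zero    = refl
deg-lift-var (_ ∷ Γ₁) Γ₂ s (suc i) with i <ᵇ length Γ₁ | deg-lift-var Γ₁ Γ₂ s i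
... | true  | eq = eq
... | false | eq = eq

deg-lift : ∀ Γ₁ Γ₂ s B → deg (Γ₁ ++ s ∷ Γ₂) (lift 1 (length Γ₁) B) ≡ deg (Γ₁ ++ Γ₂) B
deg-lift Γ₁ Γ₂ s (srt _)            = refl
deg-lift Γ₁ Γ₂ s (var i)            = deg-lift-var Γ₁ Γ₂ s i
deg-lift Γ₁ Γ₂ s (bind _ s′ _ _ B) = deg-lift (s′ ∷ Γ₁) Γ₂ s B
deg-lift Γ₁ Γ₂ s (app M _)          = deg-lift Γ₁ Γ₂ s M

deg-arr : ∀ Γ A B → deg Γ (arr Γ A B) ≡ deg Γ B
deg-arr Γ A B = deg-lift [] Γ (arrowSort (deg Γ A)) B

⊢weaken : Δ ⊢[ R ] A ∶ srt ς → All (λ B → Δ ⊢[ R ] B ∶ A) ρ →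
          Δ ⊢[ R ] C ∶ D → (decl ς ρ A ∷ Δ) ⊢[ R ] wk C ∶ wk D
⊢weaken ⊢A ⊢ρ ⊢C = weak (start ⊢A ⊢ρ) ⊢C

⊢arrow : Δ ⊢[ R ] A ∶ srt ς′ → Δ ⊢[ R ] B ∶ srt ς → R ς′ ς →
         Δ ⊢[ R ] bind pi ς′ [] A (wk B) ∶ srt ς
⊢arrow ⊢A ⊢B r = Πrule (⊢weaken ⊢A [] ⊢B) ⊢A r

⊢arr⋆ : ∀ Γ → R star star → deg Γ A ≡ 1 → Δ ⊢[ R ] A ∶ ⋆ → Δ ⊢[ R ] B ∶ ⋆ →
        Δ ⊢[ R ] arr Γ A B ∶ ⋆
⊢arr⋆ Γ ⋆⋆ deg≡1 ⊢A ⊢B rewrite deg≡1 = ⊢arrow ⊢A ⊢B ⋆⋆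

⊢starN : R box box → Δ ⊢[ R ] ⋆ ∶ srt box → ∀ q → Δ ⊢[ R ] starN q ∶ srt box
⊢starN □□ ⊢⋆ zero    = ⊢⋆
⊢starN □□ ⊢⋆ (suc q) = ⊢arrow ⊢⋆ (⊢starN □□ ⊢⋆ q) □□

extend⋆ : ℕ → Ctx → Ctx
extend⋆ zero    Δ = Δ
extend⋆ (suc n) Δ = decl box [] ⋆ ∷ extend⋆ n Δ

extend⋆-suc : ∀ n Δ → extend⋆ n (decl box [] ⋆ ∷ Δ) ≡ extend⋆ (suc n) Δ
extend⋆-suc zero    Δ = refl
extend⋆-suc (suc n) Δ = cong (decl box [] ⋆ ∷_) (extend⋆-suc n Δ)

⊢⋆-extend⋆ : Δ ⊢[ R ] ⋆ ∶ srt box → ∀ n → extend⋆ n Δ ⊢[ R ] ⋆ ∶ srt box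
⊢⋆-extend⋆ ⊢⋆ zero    = ⊢⋆
⊢⋆-extend⋆ {Δ = Δ} {R = R} ⊢⋆ (suc n) = ⊢weaken ⊢⋆ₙ [] ⊢⋆ₙ
  where
  ⊢⋆ₙ : extend⋆ n Δ ⊢[ R ] ⋆ ∶ srt box
  ⊢⋆ₙ = ⊢⋆-extend⋆ ⊢⋆ n

⊢var-extend⋆ : Δ ⊢[ R ] ⋆ ∶ srt box → ∀ {n k} → k < n → extend⋆ n Δ ⊢[ R ] var k ∶ ⋆
⊢var-extend⋆ ⊢⋆ {suc n}         z<s       = start (⊢⋆-extend⋆ ⊢⋆ n) []
⊢var-extend⋆ ⊢⋆ {suc n} {suc k} (s<s k<n) = ⊢weaken (⊢⋆-extend⋆ ⊢⋆ n) [] (⊢var-extend⋆ ⊢⋆ k<n)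

⊢lams : R box box → Δ ⊢[ R ] ⋆ ∶ srt box →
        ∀ n {t} → extend⋆ n Δ ⊢[ R ] t ∶ ⋆ → Δ ⊢[ R ] lams n t ∶ starN n
⊢lams □□ ⊢⋆ zero    ⊢t = ⊢t
⊢lams {R = R} {Δ = Δ} □□ ⊢⋆ (suc n) {t} ⊢t = λrule ⊢body (⊢starN □□ ⊢⋆ (suc n))
  where
  ⊢t′ : extend⋆ n (decl box [] ⋆ ∷ Δ) ⊢[ R ] t ∶ ⋆
  ⊢t′ = subst (λ Δ′ → Δ′ ⊢[ R ] t ∶ ⋆) (sym (extend⋆-suc n Δ)) ⊢t
  ⊢body : (decl box [] ⋆ ∷ Δ) ⊢[ R ] lams n t ∶ wk (starN n)
  ⊢body = subst (λ T → (decl box [] ⋆ ∷ Δ) ⊢[ R ] lams n t ∶ T) (sym (lift-starN 1 0 n))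
                (⊢lams □□ (⊢weaken ⊢⋆ [] ⊢⋆) n ⊢t′)

⊢P : R box box → Δ ⊢[ R ] ⋆ ∶ srt box → ∀ {i q} → i < q → Δ ⊢[ R ] P (suc i) q ∶ starN q
⊢P □□ ⊢⋆ {q = q} i<q = ⊢lams □□ ⊢⋆ q (⊢var-extend⋆ ⊢⋆ (∸-monoʳ-< z<s i<q))

⊢restriction-δz : R box box → Δ ⊢[ R ] ⋆ ∶ srt box →
                  ∀ q → All (λ B → Δ ⊢[ R ] B ∶ starN q) (drest (δz q))
⊢restriction-δz □□ ⊢⋆ q = map⁺ (applyUpTo⁺₁ _ q (⊢P □□ ⊢⋆))

⊢weaken-δz : R box box → Δ ⊢[ R ] ⋆ ∶ srt box →
             ∀ q → Δ ⊢[ R ] C ∶ D → (δz q ∷ Δ) ⊢[ R ] wk C ∶ wk D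
⊢weaken-δz □□ ⊢⋆ q = ⊢weaken (⊢starN □□ ⊢⋆ q) (⊢restriction-δz □□ ⊢⋆ q)

⊢z : R box box → Δ ⊢[ R ] ⋆ ∶ srt box → ∀ q → (δz q ∷ Δ) ⊢[ R ] var 0 ∶ starN q
⊢z {R = R} {Δ = Δ} □□ ⊢⋆ q =
  subst (λ T → (δz q ∷ Δ) ⊢[ R ] var 0 ∶ T) (lift-starN 1 0 q)
        (start (⊢starN □□ ⊢⋆ q) (⊢restriction-δz □□ ⊢⋆ q))

⊢app-starN : Δ ⊢[ R ] F ∶ starN (suc q) → Δ ⊢[ R ] A ∶ ⋆ → Δ ⊢[ R ] app F A ∶ starN q
⊢app-starN {Δ = Δ} {R = R} {F = F} {q = q} {A = A} ⊢F ⊢A =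
  subst (λ T → Δ ⊢[ R ] app F A ∶ T) sub-wk-starN (apprule ⊢F ⊢A tt)
  where
  sub-wk-starN : sub 0 A (wk (starN q)) ≡ starN q
  sub-wk-starN = trans (cong (sub 0 A) (lift-starN 1 0 q)) (sub-starN 0 A q)

⊢app2 : Δ ⊢[ R ] F ∶ starN 2 → Δ ⊢[ R ] A ∶ ⋆ → Δ ⊢[ R ] B ∶ ⋆ → Δ ⊢[ R ] app (app F A) B ∶ ⋆
⊢app2 ⊢F ⊢A ⊢B = ⊢app-starN {q = 0} (⊢app-starN {q = 1} ⊢F ⊢A) ⊢B

⊢app3 : Δ ⊢[ R ] F ∶ starN 3 → Δ ⊢[ R ] A ∶ ⋆ → Δ ⊢[ R ] B ∶ ⋆ → Δ ⊢[ R ] C ∶ ⋆ →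
        Δ ⊢[ R ] app3 F A B C ∶ ⋆
⊢app3 ⊢F ⊢A = ⊢app2 (⊢app-starN {q = 2} ⊢F ⊢A)

module OpsTyping (Γ : List Sort) where
  open Ops Γ

  deg-barN : ∀ i X → deg Γ (barN i X) ≡ deg Γ X
  deg-barN zero    X = refl
  deg-barN (suc i) X = trans (deg-arr Γ (barN i X) (barN i X)) (deg-barN i X)

  deg-under : ∀ X → deg Γ (under X) ≡ deg Γ X
  deg-under X = trans (deg-arr Γ X (tilde X)) (deg-arr Γ (bar X) X)

  deg-underN : ∀ i X → deg Γ (underN i X) ≡ deg Γ X
  deg-underN zero    X = refl
  deg-underN (suc i) X = trans (deg-under (underN i X)) (deg-underN i X)

  ⊢bar : R star star → deg Γ X ≡ 1 → Δ ⊢[ R ] X ∶ ⋆ → Δ ⊢[ R ] bar X ∶ ⋆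
  ⊢bar ⋆⋆ deg≡1 ⊢X = ⊢arr⋆ Γ ⋆⋆ deg≡1 ⊢X ⊢X

  ⊢tilde : R star star → deg Γ X ≡ 1 → Δ ⊢[ R ] X ∶ ⋆ → Δ ⊢[ R ] tilde X ∶ ⋆
  ⊢tilde {X = X} ⋆⋆ deg≡1 ⊢X =
    ⊢arr⋆ Γ ⋆⋆ (trans (deg-arr Γ X X) deg≡1) (⊢bar ⋆⋆ deg≡1 ⊢X) ⊢X

  ⊢under : R star star → deg Γ X ≡ 1 → Δ ⊢[ R ] X ∶ ⋆ → Δ ⊢[ R ] under X ∶ ⋆
  ⊢under ⋆⋆ deg≡1 ⊢X = ⊢arr⋆ Γ ⋆⋆ deg≡1 ⊢X (⊢tilde ⋆⋆ deg≡1 ⊢X)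

  ⊢barN : R star star → deg Γ X ≡ 1 → Δ ⊢[ R ] X ∶ ⋆ → ∀ i → Δ ⊢[ R ] barN i X ∶ ⋆
  ⊢barN ⋆⋆ deg≡1 ⊢X zero    = ⊢X
  ⊢barN {X = X} ⋆⋆ deg≡1 ⊢X (suc i) =
    ⊢bar ⋆⋆ (trans (deg-barN i X) deg≡1) (⊢barN ⋆⋆ deg≡1 ⊢X i)

  ⊢underN : R star star → deg Γ X ≡ 1 → Δ ⊢[ R ] X ∶ ⋆ → ∀ i → Δ ⊢[ R ] underN i X ∶ ⋆
  ⊢underN ⋆⋆ deg≡1 ⊢X zero    = ⊢X
  ⊢underN {X = X} ⋆⋆ deg≡1 ⊢X (suc i) =
    ⊢under ⋆⋆ (trans (deg-underN i X) deg≡1) (⊢underN ⋆⋆ deg≡1 ⊢X i)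

⊢⋆-ctxY : ctxY ⊢[ R ] ⋆ ∶ srt box
⊢⋆-ctxY = ⊢weaken axiom [] axiom

module _ {R : RuleSet} (□□ : R box box) where
  open Y1 using (y; z)

  ⊢y : ∀ q → (δz q ∷ ctxY) ⊢[ R ] y ∶ ⋆
  ⊢y q = ⊢weaken-δz □□ ⊢⋆-ctxY q (start axiom [])

  ⊢z₃ : ctxYZ3 ⊢[ R ] z ∶ starN 3
  ⊢z₃ = ⊢z □□ ⊢⋆-ctxY 3

  ⊢z₂ : ctxYZ2 ⊢[ R ] z ∶ starN 2
  ⊢z₂ = ⊢z □□ ⊢⋆-ctxY 2

module _ {R : RuleSet} (⋆⋆ : R star star) (□□ : R box box) where
  open Y1 using (y; barN; under)
  open OpsTyping Γ₂

  ⊢ȳ : ∀ {q} i → (δz q ∷ ctxY) ⊢[ R ] barN i y ∶ ⋆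
  ⊢ȳ {q} = ⊢barN ⋆⋆ refl (⊢y □□ q)

  ⊢y̲ : ∀ {q} → (δz q ∷ ctxY) ⊢[ R ] under y ∶ ⋆
  ⊢y̲ {q} = ⊢under ⋆⋆ refl (⊢y □□ q)

  ⊢termF : ctxYZ3 ⊢[ R ] termF ∶ ⋆
  ⊢termF = ⊢app3 (⊢z₃ □□) (⊢ȳ 3) (⊢ȳ 2) (⊢ȳ 1)

  ⊢termS : ctxYZ3 ⊢[ R ] termS ∶ ⋆
  ⊢termS = ⊢app3 (⊢z₃ □□) (⊢ȳ 2) (⊢ȳ 1) (⊢y □□ 3)

  ⊢termQ : ctxYZ3 ⊢[ R ] termQ ∶ ⋆
  ⊢termQ = ⊢app3 (⊢z₃ □□) ⊢y̲ (⊢y □□ 3) ⊢y̲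

  ⊢termG : ctxYZ3 ⊢[ R ] termG ∶ ⋆
  ⊢termG = ⊢app3 (⊢z₃ □□) (⊢underN ⋆⋆ refl (⊢y □□ 3) 2) (⊢ȳ 1) (⊢bar ⋆⋆ refl ⊢y̲)

  ⊢termM : ctxYZ3 ⊢[ R ] termM ∶ ⋆
  ⊢termM = ⊢app3 (⊢z₃ □□) (⊢tilde ⋆⋆ refl ⊢y̲) (⊢y □□ 3) ⊢y̲

  ⊢termB : ctxYZ3 ⊢[ R ] termB ∶ ⋆
  ⊢termB = ⊢arr⋆ Γ₂ ⋆⋆ refl ⊢termF (⊢arr⋆ Γ₂ ⋆⋆ refl ⊢termS ⊢termS)

  ⊢termA : ctxYZ3 ⊢[ R ] termA ∶ ⋆
  ⊢termA = ⊢arr⋆ Γ₂ ⋆⋆ refl ⊢termQ (⊢arr⋆ Γ₂ ⋆⋆ refl ⊢termG ⊢termM)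

  ⊢termC : ctxYZ2 ⊢[ R ] termC ∶ ⋆
  ⊢termC = ⊢app2 (⊢z₂ □□) (⊢ȳ 2) (⊢tilde ⋆⋆ refl ⊢y̲)

lemma2 : (R : RuleSet) → R star star → R box box → R box star →
    All (λ H → ctxYZ3 ⊢[ R ] H ∶ ⋆)
        (termF ∷ termS ∷ termB ∷ termQ ∷ termG ∷ termM ∷ termA ∷ [])
    × All (λ J → ctxY ⊢[ R ] J ∶ ⋆) (termE ∷ termD ∷ termR ∷ [])
    × ctxYZ2 ⊢[ R ] termC ∶ ⋆
    × ctxYZ2 ⊢[ R ] termR' ∶ ⋆
lemma2 R ⋆⋆ □□ □⋆ =
  (⊢termF ⋆⋆ □□ ∷ ⊢termS ⋆⋆ □□ ∷ ⊢termB ⋆⋆ □□ ∷ ⊢termQ ⋆⋆ □□ ∷ ⊢termG ⋆⋆ □□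
     ∷ ⊢termM ⋆⋆ □□ ∷ ⊢termA ⋆⋆ □□ ∷ []) ,
  (⊢termE ∷ ⊢termD ∷ ⊢termR ∷ []) , ⊢termC ⋆⋆ □□ , ⊢termR′
  where
  ⊢termE : ctxY ⊢[ R ] termE ∶ ⋆
  ⊢termE = Πrule (⊢termB ⋆⋆ □□) (⊢starN □□ ⊢⋆-ctxY 3) □⋆

  ⊢termD : ctxY ⊢[ R ] termD ∶ ⋆
  ⊢termD = Πrule (⊢termA ⋆⋆ □□) (⊢starN □□ ⊢⋆-ctxY 3) □⋆

  ⊢termO : ctxYZ2 ⊢[ R ] termO ∶ ⋆
  ⊢termO = ⊢app2 (⊢z₂ □□) (⊢weaken-δz □□ ⊢⋆-ctxY 2 ⊢termE) (⊢weaken-δz □□ ⊢⋆-ctxY 2 ⊢termD)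

  ⊢termR′ : ctxYZ2 ⊢[ R ] termR' ∶ ⋆
  ⊢termR′ = ⊢arr⋆ Γ₂ ⋆⋆ refl ⊢termO (⊢termC ⋆⋆ □□)

  ⊢termR : ctxY ⊢[ R ] termR ∶ ⋆
  ⊢termR = Πrule ⊢termR′ (⊢starN □□ ⊢⋆-ctxY 2) □⋆
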